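{- There is no infinite reduction sequence starting from any well-typed t-closed e-term of the ptq-calculus.
   Context: The ptq-calculus. Intuitionistic types $A::=X\mid A\to A$; for each $A$ types $A^{\mathsf p},A^{\mathsf t},A^{\mathsf q}$. Terms: p-variables; a t-variable $k$; a constant $*$. p-terms $p::=x\mid\lambda\langle x,k\rangle.u\mid\lambda k.u$; t-terms $t::=*\mid k\mid\langle p,t\rangle\mid\lambda x.u$; q-terms $q::=\overline{\lambda}k.u$; e-terms $u::=t;p\mid q\,t$. $\lambda\langle x,k\rangle$ binds $x,k$; $\lambda k,\overline\lambda k$ bind $k$; $\lambda x$ binds $x$; terms modulo $\alpha$-conversion. A term is t-closed if it has no free t-variable; for $u$ with $k$ free, $u_*:=u[*/k]$. Typing: environments $\Gamma$ or $\Gamma\rhd\delta$, $\Gamma$ a set of distinct p-variables with proof types, $\delta$ either $k:A^{\mathsf t}$ or $*:A^{\mathsf t}$. Rules: $\Gamma,x:A^{\mathsf p}\vdash x:A^{\mathsf p}$; $\Gamma\rhd k:A^{\mathsf t}\vdash k:A^{\mathsf t}$; $\Gamma\rhd *:A^{\mathsf t}\vdash *:A^{\mathsf t}$; $\Gamma,x:A^{\mathsf p}\rhd k:B^{\mathsf t}\vdash u\Rightarrow\Gamma\vdash\lambda\langle x,k\rangle.u:(A\to B)^{\mathsf p}$; $\Gamma\vdash p:A^{\mathsf p},\ \Gamma\rhd\delta\vdash t:B^{\mathsf t}\Rightarrow\Gamma\rhd\delta\vdash\langle p,t\rangle:(A\to B)^{\mathsf t}$; $\Gamma\rhd k:A^{\mathsf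 t}\vdash u\Rightarrow\Gamma\vdash\lambda k.u:A^{\mathsf p}$; $\Gamma,x:A^{\mathsf p}\rhd\delta\vdash u\Rightarrow\Gamma\rhd\delta\vdash\lambda x.u:A^{\mathsf t}$; $\Gamma\rhd k:A^{\mathsf t}\vdash u\Rightarrow\Gamma\vdash\overline\lambda k.u:A^{\mathsf q}$; $\Gamma\vdash p:A^{\mathsf p},\ \Gamma\rhd\delta\vdash t:A^{\mathsf t}\Rightarrow\Gamma\rhd\delta\vdash t;p$; $\Gamma\vdash q:A^{\mathsf q},\ \Gamma\rhd\delta\vdash t:A^{\mathsf t}\Rightarrow\Gamma\rhd\delta\vdash q\,t$. Reduction (on t-closed e-terms, only at top level; no reduction under binders or inside pairs): $*;\lambda k.u\to u[*/k]$; $\langle p,t_*\rangle;\lambda k.u\to u[\langle p,t_*\rangle/k]$; $\langle p,t_*\rangle;\lambda\langle x,k\rangle.u\to u[p/x,t_*/k]$; $(\lambda x.u_*);p\to u_*[p/x]$; $(\overline\lambda k.u)\,t_*\to u[t_*/k]$. -}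

module Defs where

-- The ptq-calculus, with p-variables in de Bruijn form (terms modulo
-- alpha-conversion).  There is a single t-variable name k; an occurrence  kvar  refers to
-- the innermost enclosing k-binder (λ⟨x,k⟩, λk, λ̄k), or is free if none.

open import Data.Nat using (ℕ; zero; suc)
open import Data.Fin using (Fin; zero; suc)
open import Data.Bool using (Bool; true; false; _∨_)
open import Data.Vec using (Vec; _∷_; lookup)
open import Data.Product using (_×_)
open import Relation.Binary.PropositionalEquality using (_≡_)

infixr 30 _⇒_
data Ty : Set where
  atom : ℕ → Ty
  _⇒_  : Ty → Ty → Ty

data PTerm (n : ℕ) : Set
data TTerm (n : ℕ) : Set
data QTerm (n : ℕ) : Set
data ETerm (n : ℕ) : Set

data PTerm n where
  var     : Fin n → PTerm n
  lamPair : ETerm (suc n) → PTerm n   -- λ⟨x,k⟩.u  (x is de Bruijn 0, binds k)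
  lamK    : ETerm n → PTerm n

data TTerm n where
  star : TTerm n
  kvar : TTerm n
  pair : PTerm n → TTerm n → TTerm n
  lamX : ETerm (suc n) → TTerm n

data QTerm n where
  lamBarK : ETerm n → QTerm n

infix 25 _︔_
data ETerm n where
  _︔_ : TTerm n → PTerm n → ETerm n
  app : QTerm n → TTerm n → ETerm n

freeKP : ∀ {n} → PTerm n → Bool
freeKT : ∀ {n} → TTerm n → Bool
freeKQ : ∀ {n} → QTerm n → Bool
freeKE : ∀ {n} → ETerm n → Bool

freeKP (var x)     = false
freeKP (lamPair u) = false
freeKP (lamK u)    = false
freeKT star        = false
freeKT kvar        = true
freeKT (pair p t)  = freeKP p ∨ freeKT t
freeKT (lamX u)    = freeKE u
freeKQ (lamBarK u) = false
freeKE (t ︔ p)    = freeKT t ∨ freeKP p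
freeKE (app q t)   = freeKQ q ∨ freeKT t

TClosedT : ∀ {n} → TTerm n → Set
TClosedT t = freeKT t ≡ false

TClosedE : ∀ {n} → ETerm n → Set
TClosedE u = freeKE u ≡ false

extR : ∀ {n m} → (Fin n → Fin m) → Fin (suc n) → Fin (suc m)
extR ρ zero    = zero
extR ρ (suc i) = suc (ρ i)

renP : ∀ {n m} → (Fin n → Fin m) → PTerm n → PTerm m
renT : ∀ {n m} → (Fin n → Fin m) → TTerm n → TTerm m
renQ : ∀ {n m} → (Fin n → Fin m) → QTerm n → QTerm m
renE : ∀ {n m} → (Fin n → Fin m) → ETerm n → ETerm m

renP ρ (var x)     = var (ρ x)
renP ρ (lamPair u) = lamPair (renE (extR ρ) u)
renP ρ (lamK u)    = lamK (renE ρ u)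
renT ρ star        = star
renT ρ kvar        = kvar
renT ρ (pair p t)  = pair (renP ρ p) (renT ρ t)
renT ρ (lamX u)    = lamX (renE (extR ρ) u)
renQ ρ (lamBarK u) = lamBarK (renE ρ u)
renE ρ (t ︔ p)    = renT ρ t ︔ renP ρ p
renE ρ (app q t)   = app (renQ ρ q) (renT ρ t)

-- Substitution of p-terms for p-variables (capture-avoiding; p-terms never
-- contain a free k, so no t-variable capture can occur)

extS : ∀ {n m} → (Fin n → PTerm m) → Fin (suc n) → PTerm (suc m)
extS σ zero    = var zero
extS σ (suc i) = renP suc (σ i)

subP : ∀ {n m} → (Fin n → PTerm m) → PTerm n → PTerm m
subT : ∀ {n m} → (Fin n → PTerm m) → TTerm n → TTerm m
subQ : ∀ {n m} → (Fin n → PTerm m) → QTerm n → QTerm m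
subE : ∀ {n m} → (Fin n → PTerm m) → ETerm n → ETerm m

subP σ (var x)     = σ x
subP σ (lamPair u) = lamPair (subE (extS σ) u)
subP σ (lamK u)    = lamK (subE σ u)
subT σ star        = star
subT σ kvar        = kvar
subT σ (pair p t)  = pair (subP σ p) (subT σ t)
subT σ (lamX u)    = lamX (subE (extS σ) u)
subQ σ (lamBarK u) = lamBarK (subE σ u)
subE σ (t ︔ p)    = subT σ t ︔ subP σ p
subE σ (app q t)   = app (subQ σ q) (subT σ t)

single : ∀ {n} → PTerm n → Fin (suc n) → PTerm n
single p zero    = p
single p (suc i) = var i

_[_]₀ : ∀ {n} → ETerm (suc n) → PTerm n → ETerm n
u [ p ]₀ = subE (single p) u

ksubP : ∀ {n} → TTerm n → PTerm n → PTerm n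
ksubT : ∀ {n} → TTerm n → TTerm n → TTerm n
ksubQ : ∀ {n} → TTerm n → QTerm n → QTerm n
ksubE : ∀ {n} → TTerm n → ETerm n → ETerm n

ksubP s (var x)     = var x
ksubP s (lamPair u) = lamPair u
ksubP s (lamK u)    = lamK u
ksubT s star        = star
ksubT s kvar        = s
ksubT s (pair p t)  = pair (ksubP s p) (ksubT s t)
ksubT s (lamX u)    = lamX (ksubE (renT suc s) u)
ksubQ s (lamBarK u) = lamBarK u
ksubE s (t ︔ p)    = ksubT s t ︔ ksubP s p
ksubE s (app q t)   = app (ksubQ s q) (ksubT s t)

_[_]ₖ : ∀ {n} → ETerm n → TTerm n → ETerm n
u [ s ]ₖ = ksubE s u

-- Typing.  A context Γ assigns proof types A^p to p-variables; δ is
-- either  k : A^t  or  * : A^t.  (The sorts p/t/q are recorded by which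
-- judgment is used.)

Ctx : ℕ → Set
Ctx n = Vec Ty n

data Decl : Set where
  kdecl    : Ty → Decl
  stardecl : Ty → Decl

data _⊢p_∶_ {n} (Γ : Ctx n) : PTerm n → Ty → Set
data _▷_⊢t_∶_ {n} (Γ : Ctx n) (δ : Decl) : TTerm n → Ty → Set
data _⊢q_∶_ {n} (Γ : Ctx n) : QTerm n → Ty → Set
data _▷_⊢e_ {n} (Γ : Ctx n) (δ : Decl) : ETerm n → Set

data _⊢p_∶_ {n} Γ where
  ty-var     : ∀ i → Γ ⊢p var i ∶ lookup Γ i
  ty-lamPair : ∀ {A B u} → (A ∷ Γ) ▷ kdecl B ⊢e u → Γ ⊢p lamPair u ∶ (A ⇒ B)
  ty-lamK    : ∀ {A u} → Γ ▷ kdecl A ⊢e u → Γ ⊢p lamK u ∶ A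

data _▷_⊢t_∶_ {n} Γ δ where
  ty-kvar : ∀ {A} → δ ≡ kdecl A → Γ ▷ δ ⊢t kvar ∶ A
  ty-star : ∀ {A} → δ ≡ stardecl A → Γ ▷ δ ⊢t star ∶ A
  ty-pair : ∀ {A B p t} → Γ ⊢p p ∶ A → Γ ▷ δ ⊢t t ∶ B → Γ ▷ δ ⊢t pair p t ∶ (A ⇒ B)
  ty-lamX : ∀ {A u} → (A ∷ Γ) ▷ δ ⊢e u → Γ ▷ δ ⊢t lamX u ∶ A

data _⊢q_∶_ {n} Γ where
  ty-lamBarK : ∀ {A u} → Γ ▷ kdecl A ⊢e u → Γ ⊢q lamBarK u ∶ A

data _▷_⊢e_ {n} Γ δ where
  ty-cut : ∀ {A t p} → Γ ⊢p p ∶ A → Γ ▷ δ ⊢t t ∶ A → Γ ▷ δ ⊢e (t ︔ p)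
  ty-app : ∀ {A q t} → Γ ⊢q q ∶ A → Γ ▷ δ ⊢t t ∶ A → Γ ▷ δ ⊢e app q t

-- Reduction: top level only, on t-closed e-terms.  "t_*" denotes a
-- t-closed t-term.

data _↦_ {n} : ETerm n → ETerm n → Set where
  r-star     : ∀ {u} → (star ︔ lamK u) ↦ (u [ star ]ₖ)
  r-pairK    : ∀ {p t u} → TClosedT t →
               (pair p t ︔ lamK u) ↦ (u [ pair p t ]ₖ)
  r-pairPair : ∀ {p t u} → TClosedT t →
               (pair p t ︔ lamPair u) ↦ ((u [ p ]₀) [ t ]ₖ)
  r-lamX     : ∀ {u p} → TClosedE u → (lamX u ︔ p) ↦ (u [ p ]₀)
  r-lamBarK  : ∀ {u t} → TClosedT t → app (lamBarK u) t ↦ (u [ t ]ₖ)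

infix 4 _⟶_
_⟶_ : ∀ {n} → ETerm n → ETerm n → Set
u ⟶ u' = TClosedE u × (u ↦ u')

-- Strong normalisation by reducibility candidates defined by orthogonality.
-- A t-term is reducible at A when its cut with every reducible p-term of
-- type A is strongly normalising; a p-term is reducible at A when its cut
-- with every "value" of type A is, where the values are * and pairs ⟨p,t⟩
-- of reducible components (the only t-terms a p-abstraction can react with).
-- Defining p-reducibility against values rather than all reducible t-terms
-- makes the definition a recursion on the type.  Every typed term is then
-- reducible under every reducible substitution for its p-variables and its
-- t-variable; substituting the variables themselves, which are inert, gives
-- strong normalisation.

module Submission where

open import Defs
open import Data.Nat using (ℕ; zero; suc)
open import Data.Fin using (Fin; zero; suc)
open import Data.Product using (Σ; ∃₂; _×_; _,_)
open import Data.Sum using (_⊎_; inj₁; inj₂)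
open import Data.Empty using (⊥)
open import Data.Vec using (_∷_; lookup)
open import Data.Vec.Functional using () renaming (_∷_ to _∷ˢ_)
open import Function using (_∘_; flip)
open import Induction.WellFounded using (Acc; acc)
open import Induction.InfiniteDescent
  using (Descent; InfiniteDescendingSequenceFrom; descent∧acc⇒unsatisfiable)
open import Relation.Binary.Core using (Rel)
open import Relation.Binary.PropositionalEquality
  using (_≡_; _≗_; refl; sym; trans; cong; cong₂; subst; module ≡-Reasoning)
open import Relation.Nullary using (¬_)

acc⇒¬infiniteDescent : ∀ {a r} {A : Set a} {_<_ : Rel A r} {x : A} →
  Acc _<_ x → ¬ Σ (ℕ → A) (λ f → InfiniteDescendingSequenceFrom _<_ f x)
acc⇒¬infiniteDescent {_<_ = _<_} = descent∧acc⇒unsatisfiable shift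
  where
  shift : Descent _<_ (λ x → Σ _ (λ f → InfiniteDescendingSequenceFrom _<_ f x))
  shift (f , refl , desc) = f 1 , desc 0 , f ∘ suc , refl , desc ∘ suc

extR-∘ : ∀ {a b c} {ρ : Fin b → Fin c} {ρ′ : Fin a → Fin b} {ρ″ : Fin a → Fin c} →
  ρ ∘ ρ′ ≗ ρ″ → extR ρ ∘ extR ρ′ ≗ extR ρ″
extR-∘ h zero    = refl
extR-∘ h (suc i) = cong suc (h i)

renP-renP : ∀ {a b c} (ρ : Fin b → Fin c) (ρ′ : Fin a → Fin b) (ρ″ : Fin a → Fin c) →
  ρ ∘ ρ′ ≗ ρ″ → ∀ p → renP ρ (renP ρ′ p) ≡ renP ρ″ p
renT-renT : ∀ {a b c} (ρ : Fin b → Fin c) (ρ′ : Fin a → Fin b) (ρ″ : Fin a → Fin c) →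
  ρ ∘ ρ′ ≗ ρ″ → ∀ t → renT ρ (renT ρ′ t) ≡ renT ρ″ t
renQ-renQ : ∀ {a b c} (ρ : Fin b → Fin c) (ρ′ : Fin a → Fin b) (ρ″ : Fin a → Fin c) →
  ρ ∘ ρ′ ≗ ρ″ → ∀ q → renQ ρ (renQ ρ′ q) ≡ renQ ρ″ q
renE-renE : ∀ {a b c} (ρ : Fin b → Fin c) (ρ′ : Fin a → Fin b) (ρ″ : Fin a → Fin c) →
  ρ ∘ ρ′ ≗ ρ″ → ∀ u → renE ρ (renE ρ′ u) ≡ renE ρ″ u

renP-renP ρ ρ′ ρ″ h (var x)     = cong var (h x)
renP-renP ρ ρ′ ρ″ h (lamPair u) = cong lamPair (renE-renE (extR ρ) (extR ρ′) (extR ρ″) (extR-∘ h) u)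
renP-renP ρ ρ′ ρ″ h (lamK u)    = cong lamK (renE-renE ρ ρ′ ρ″ h u)
renT-renT ρ ρ′ ρ″ h star        = refl
renT-renT ρ ρ′ ρ″ h kvar        = refl
renT-renT ρ ρ′ ρ″ h (pair p t)  = cong₂ pair (renP-renP ρ ρ′ ρ″ h p) (renT-renT ρ ρ′ ρ″ h t)
renT-renT ρ ρ′ ρ″ h (lamX u)    = cong lamX (renE-renE (extR ρ) (extR ρ′) (extR ρ″) (extR-∘ h) u)
renQ-renQ ρ ρ′ ρ″ h (lamBarK u) = cong lamBarK (renE-renE ρ ρ′ ρ″ h u)
renE-renE ρ ρ′ ρ″ h (t ︔ p)    = cong₂ _︔_ (renT-renT ρ ρ′ ρ″ h t) (renP-renP ρ ρ′ ρ″ h p)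
renE-renE ρ ρ′ ρ″ h (app q t)   = cong₂ app (renQ-renQ ρ ρ′ ρ″ h q) (renT-renT ρ ρ′ ρ″ h t)

extS-extR : ∀ {a b c} {σ : Fin b → PTerm c} {ρ : Fin a → Fin b} {τ : Fin a → PTerm c} →
  σ ∘ ρ ≗ τ → extS σ ∘ extR ρ ≗ extS τ
extS-extR h zero    = refl
extS-extR h (suc i) = cong (renP suc) (h i)

subP-renP : ∀ {a b c} (σ : Fin b → PTerm c) (ρ : Fin a → Fin b) (τ : Fin a → PTerm c) →
  σ ∘ ρ ≗ τ → ∀ p → subP σ (renP ρ p) ≡ subP τ p
subT-renT : ∀ {a b c} (σ : Fin b → PTerm c) (ρ : Fin a → Fin b) (τ : Fin a → PTerm c) →
  σ ∘ ρ ≗ τ → ∀ t → subT σ (renT ρ t) ≡ subT τ t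
subQ-renQ : ∀ {a b c} (σ : Fin b → PTerm c) (ρ : Fin a → Fin b) (τ : Fin a → PTerm c) →
  σ ∘ ρ ≗ τ → ∀ q → subQ σ (renQ ρ q) ≡ subQ τ q
subE-renE : ∀ {a b c} (σ : Fin b → PTerm c) (ρ : Fin a → Fin b) (τ : Fin a → PTerm c) →
  σ ∘ ρ ≗ τ → ∀ u → subE σ (renE ρ u) ≡ subE τ u

subP-renP σ ρ τ h (var x)     = h x
subP-renP σ ρ τ h (lamPair u) = cong lamPair (subE-renE (extS σ) (extR ρ) (extS τ) (extS-extR h) u)
subP-renP σ ρ τ h (lamK u)    = cong lamK (subE-renE σ ρ τ h u)
subT-renT σ ρ τ h star        = refl
subT-renT σ ρ τ h kvar        = refl
subT-renT σ ρ τ h (pair p t)  = cong₂ pair (subP-renP σ ρ τ h p) (subT-renT σ ρ τ h t)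
subT-renT σ ρ τ h (lamX u)    = cong lamX (subE-renE (extS σ) (extR ρ) (extS τ) (extS-extR h) u)
subQ-renQ σ ρ τ h (lamBarK u) = cong lamBarK (subE-renE σ ρ τ h u)
subE-renE σ ρ τ h (t ︔ p)    = cong₂ _︔_ (subT-renT σ ρ τ h t) (subP-renP σ ρ τ h p)
subE-renE σ ρ τ h (app q t)   = cong₂ app (subQ-renQ σ ρ τ h q) (subT-renT σ ρ τ h t)

extR-renP-suc : ∀ {a b} (ρ : Fin a → Fin b) (p : PTerm a) →
  renP (extR ρ) (renP suc p) ≡ renP suc (renP ρ p)
extR-renP-suc ρ p =
  trans (renP-renP (extR ρ) suc (suc ∘ ρ) (λ _ → refl) p)
        (sym (renP-renP suc ρ (suc ∘ ρ) (λ _ → refl) p))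

extR-extS : ∀ {a b c} {ρ : Fin b → Fin c} {σ : Fin a → PTerm b} {τ : Fin a → PTerm c} →
  renP ρ ∘ σ ≗ τ → renP (extR ρ) ∘ extS σ ≗ extS τ
extR-extS h zero = refl
extR-extS {ρ = ρ} {σ} h (suc i) = trans (extR-renP-suc ρ (σ i)) (cong (renP suc) (h i))

renP-subP : ∀ {a b c} (ρ : Fin b → Fin c) (σ : Fin a → PTerm b) (τ : Fin a → PTerm c) →
  renP ρ ∘ σ ≗ τ → ∀ p → renP ρ (subP σ p) ≡ subP τ p
renT-subT : ∀ {a b c} (ρ : Fin b → Fin c) (σ : Fin a → PTerm b) (τ : Fin a → PTerm c) →
  renP ρ ∘ σ ≗ τ → ∀ t → renT ρ (subT σ t) ≡ subT τ t
renQ-subQ : ∀ {a b c} (ρ : Fin b → Fin c) (σ : Fin a → PTerm b) (τ : Fin a → PTerm c) →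
  renP ρ ∘ σ ≗ τ → ∀ q → renQ ρ (subQ σ q) ≡ subQ τ q
renE-subE : ∀ {a b c} (ρ : Fin b → Fin c) (σ : Fin a → PTerm b) (τ : Fin a → PTerm c) →
  renP ρ ∘ σ ≗ τ → ∀ u → renE ρ (subE σ u) ≡ subE τ u

renP-subP ρ σ τ h (var x)     = h x
renP-subP ρ σ τ h (lamPair u) = cong lamPair (renE-subE (extR ρ) (extS σ) (extS τ) (extR-extS h) u)
renP-subP ρ σ τ h (lamK u)    = cong lamK (renE-subE ρ σ τ h u)
renT-subT ρ σ τ h star        = refl
renT-subT ρ σ τ h kvar        = refl
renT-subT ρ σ τ h (pair p t)  = cong₂ pair (renP-subP ρ σ τ h p) (renT-subT ρ σ τ h t)
renT-subT ρ σ τ h (lamX u)    = cong lamX (renE-subE (extR ρ) (extS σ) (extS τ) (extR-extS h) u)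
renQ-subQ ρ σ τ h (lamBarK u) = cong lamBarK (renE-subE ρ σ τ h u)
renE-subE ρ σ τ h (t ︔ p)    = cong₂ _︔_ (renT-subT ρ σ τ h t) (renP-subP ρ σ τ h p)
renE-subE ρ σ τ h (app q t)   = cong₂ app (renQ-subQ ρ σ τ h q) (renT-subT ρ σ τ h t)

extS-renP-suc : ∀ {a b} (σ : Fin a → PTerm b) (p : PTerm a) →
  subP (extS σ) (renP suc p) ≡ renP suc (subP σ p)
extS-renP-suc σ p =
  trans (subP-renP (extS σ) suc (renP suc ∘ σ) (λ _ → refl) p)
        (sym (renP-subP suc σ (renP suc ∘ σ) (λ _ → refl) p))

extS-renT-suc : ∀ {a b} (σ : Fin a → PTerm b) (t : TTerm a) →
  subT (extS σ) (renT suc t) ≡ renT suc (subT σ t)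
extS-renT-suc σ t =
  trans (subT-renT (extS σ) suc (renP suc ∘ σ) (λ _ → refl) t)
        (sym (renT-subT suc σ (renP suc ∘ σ) (λ _ → refl) t))

extS-extS : ∀ {a b c} {τ : Fin b → PTerm c} {σ : Fin a → PTerm b} {υ : Fin a → PTerm c} →
  subP τ ∘ σ ≗ υ → subP (extS τ) ∘ extS σ ≗ extS υ
extS-extS h zero = refl
extS-extS {τ = τ} {σ} h (suc i) = trans (extS-renP-suc τ (σ i)) (cong (renP suc) (h i))

subP-subP : ∀ {a b c} (τ : Fin b → PTerm c) (σ : Fin a → PTerm b) (υ : Fin a → PTerm c) →
  subP τ ∘ σ ≗ υ → ∀ p → subP τ (subP σ p) ≡ subP υ p
subT-subT : ∀ {a b c} (τ : Fin b → PTerm c) (σ : Fin a → PTerm b) (υ : Fin a → PTerm c) →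
  subP τ ∘ σ ≗ υ → ∀ t → subT τ (subT σ t) ≡ subT υ t
subQ-subQ : ∀ {a b c} (τ : Fin b → PTerm c) (σ : Fin a → PTerm b) (υ : Fin a → PTerm c) →
  subP τ ∘ σ ≗ υ → ∀ q → subQ τ (subQ σ q) ≡ subQ υ q
subE-subE : ∀ {a b c} (τ : Fin b → PTerm c) (σ : Fin a → PTerm b) (υ : Fin a → PTerm c) →
  subP τ ∘ σ ≗ υ → ∀ u → subE τ (subE σ u) ≡ subE υ u

subP-subP τ σ υ h (var x)     = h x
subP-subP τ σ υ h (lamPair u) = cong lamPair (subE-subE (extS τ) (extS σ) (extS υ) (extS-extS h) u)
subP-subP τ σ υ h (lamK u)    = cong lamK (subE-subE τ σ υ h u)
subT-subT τ σ υ h star        = refl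
subT-subT τ σ υ h kvar        = refl
subT-subT τ σ υ h (pair p t)  = cong₂ pair (subP-subP τ σ υ h p) (subT-subT τ σ υ h t)
subT-subT τ σ υ h (lamX u)    = cong lamX (subE-subE (extS τ) (extS σ) (extS υ) (extS-extS h) u)
subQ-subQ τ σ υ h (lamBarK u) = cong lamBarK (subE-subE τ σ υ h u)
subE-subE τ σ υ h (t ︔ p)    = cong₂ _︔_ (subT-subT τ σ υ h t) (subP-subP τ σ υ h p)
subE-subE τ σ υ h (app q t)   = cong₂ app (subQ-subQ τ σ υ h q) (subT-subT τ σ υ h t)

extS-var : ∀ {a} {σ : Fin a → PTerm a} → σ ≗ var → extS σ ≗ var
extS-var h zero    = refl
extS-var h (suc i) = cong (renP suc) (h i)

subP-id : ∀ {a} (σ : Fin a → PTerm a) → σ ≗ var → ∀ p → subP σ p ≡ p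
subT-id : ∀ {a} (σ : Fin a → PTerm a) → σ ≗ var → ∀ t → subT σ t ≡ t
subQ-id : ∀ {a} (σ : Fin a → PTerm a) → σ ≗ var → ∀ q → subQ σ q ≡ q
subE-id : ∀ {a} (σ : Fin a → PTerm a) → σ ≗ var → ∀ u → subE σ u ≡ u

subP-id σ h (var x)     = h x
subP-id σ h (lamPair u) = cong lamPair (subE-id (extS σ) (extS-var h) u)
subP-id σ h (lamK u)    = cong lamK (subE-id σ h u)
subT-id σ h star        = refl
subT-id σ h kvar        = refl
subT-id σ h (pair p t)  = cong₂ pair (subP-id σ h p) (subT-id σ h t)
subT-id σ h (lamX u)    = cong lamX (subE-id (extS σ) (extS-var h) u)
subQ-id σ h (lamBarK u) = cong lamBarK (subE-id σ h u)
subE-id σ h (t ︔ p)    = cong₂ _︔_ (subT-id σ h t) (subP-id σ h p)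
subE-id σ h (app q t)   = cong₂ app (subQ-id σ h q) (subT-id σ h t)

single-renP-suc : ∀ {a} (p q : PTerm a) → subP (single p) (renP suc q) ≡ q
single-renP-suc p q = trans (subP-renP (single p) suc var (λ _ → refl) q) (subP-id var (λ _ → refl) q)

single-renT-suc : ∀ {a} (p : PTerm a) (t : TTerm a) → subT (single p) (renT suc t) ≡ t
single-renT-suc p t = trans (subT-renT (single p) suc var (λ _ → refl) t) (subT-id var (λ _ → refl) t)

single-extS : ∀ {a b} (p : PTerm b) (σ : Fin a → PTerm b) (u : ETerm (suc a)) →
  subE (extS σ) u [ p ]₀ ≡ subE (p ∷ˢ σ) u
single-extS p σ = subE-subE (single p) (extS σ) (p ∷ˢ σ) single∘extS
  where
  single∘extS : subP (single p) ∘ extS σ ≗ p ∷ˢ σ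
  single∘extS zero    = refl
  single∘extS (suc i) = single-renP-suc p (σ i)

ksubP-vacuous : ∀ {a} (s : TTerm a) (p : PTerm a) → ksubP s p ≡ p
ksubP-vacuous s (var x)     = refl
ksubP-vacuous s (lamPair u) = refl
ksubP-vacuous s (lamK u)    = refl

subP-ksubP : ∀ {a b} (τ : Fin a → PTerm b) (s : TTerm a) (p : PTerm a) →
  subP τ (ksubP s p) ≡ ksubP (subT τ s) (subP τ p)
subP-ksubP τ s p = trans (cong (subP τ) (ksubP-vacuous s p)) (sym (ksubP-vacuous (subT τ s) (subP τ p)))

subT-ksubT : ∀ {a b} (τ : Fin a → PTerm b) (s t : TTerm a) →
  subT τ (ksubT s t) ≡ ksubT (subT τ s) (subT τ t)
subE-ksubE : ∀ {a b} (τ : Fin a → PTerm b) (s : TTerm a) (u : ETerm a) →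
  subE τ (ksubE s u) ≡ ksubE (subT τ s) (subE τ u)

subT-ksubT τ s star       = refl
subT-ksubT τ s kvar       = refl
subT-ksubT τ s (pair p t) = cong₂ pair (subP-ksubP τ s p) (subT-ksubT τ s t)
subT-ksubT τ s (lamX u)   = cong lamX (trans (subE-ksubE (extS τ) (renT suc s) u)
  (cong (λ s′ → ksubE s′ (subE (extS τ) u)) (extS-renT-suc τ s)))
subE-ksubE τ s (t ︔ p)   = cong₂ _︔_ (subT-ksubT τ s t) (subP-ksubP τ s p)
subE-ksubE τ s (app (lamBarK u) t) = cong (app (lamBarK (subE τ u))) (subT-ksubT τ s t)

ksubT-kvar : ∀ {a} (t : TTerm a) → ksubT kvar t ≡ t
ksubE-kvar : ∀ {a} (u : ETerm a) → ksubE kvar u ≡ u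
ksubT-kvar star       = refl
ksubT-kvar kvar       = refl
ksubT-kvar (pair p t) = cong₂ pair (ksubP-vacuous kvar p) (ksubT-kvar t)
ksubT-kvar (lamX u)   = cong lamX (ksubE-kvar u)
ksubE-kvar (t ︔ p)   = cong₂ _︔_ (ksubT-kvar t) (ksubP-vacuous kvar p)
ksubE-kvar (app (lamBarK u) t) = cong (app (lamBarK u)) (ksubT-kvar t)

SN : ∀ {n} → ETerm n → Set
SN = Acc (flip _⟶_)

declTy : Decl → Ty
declTy (kdecl A)    = A
declTy (stardecl A) = A

module Reducibility (n : ℕ) where

  ⟦_⟧ᵖ : Ty → PTerm n → Set
  ⟦_⟧ᵗ : Ty → TTerm n → Set
  ⟦_⟧ᵛ : Ty → TTerm n → Set
  ⟦_⟧ᵖᵃⁱʳ : Ty → TTerm n → Set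

  ⟦ A ⟧ᵖ p = ∀ t → ⟦ A ⟧ᵛ t → SN (t ︔ p)
  ⟦ A ⟧ᵗ t = ∀ p → ⟦ A ⟧ᵖ p → SN (t ︔ p)
  ⟦ A ⟧ᵛ t = t ≡ star ⊎ ⟦ A ⟧ᵖᵃⁱʳ t
  ⟦ atom _ ⟧ᵖᵃⁱʳ t = ⊥
  ⟦ A ⇒ B ⟧ᵖᵃⁱʳ t = ∃₂ λ p t′ → t ≡ pair p t′ × ⟦ A ⟧ᵖ p × ⟦ B ⟧ᵗ t′

  star-reducible : ∀ A → ⟦ A ⟧ᵗ star
  star-reducible A p ⊨p = ⊨p star (inj₁ refl)

  pair-reducible : ∀ {A B p t} → ⟦ A ⟧ᵖ p → ⟦ B ⟧ᵗ t → ⟦ A ⇒ B ⟧ᵗ (pair p t)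
  pair-reducible ⊨p ⊨t p′ ⊨p′ = ⊨p′ _ (inj₂ (_ , _ , refl , ⊨p , ⊨t))

  kvar-reducible : ∀ A → ⟦ A ⟧ᵗ kvar
  kvar-reducible A p ⊨p = acc λ { (_ , ()) }

  var-reducible : ∀ A i → ⟦ A ⟧ᵖ (var i)
  var-reducible A i t (inj₁ refl) = acc λ { (_ , ()) }
  var-reducible (A ⇒ B) i t (inj₂ (_ , _ , refl , _)) = acc λ { (_ , ()) }

  lamK-reducible : ∀ A u → (∀ t → ⟦ A ⟧ᵗ t → SN (u [ t ]ₖ)) → ⟦ A ⟧ᵖ (lamK u)
  lamK-reducible A u h t (inj₁ refl) = acc λ { (_ , r-star) → h star (star-reducible A) }
  lamK-reducible (A ⇒ B) u h t (inj₂ (p , t′ , refl , ⊨p , ⊨t′)) =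
    acc λ { (_ , r-pairK _) → h (pair p t′) (pair-reducible ⊨p ⊨t′) }

  lamPair-reducible : ∀ A B u → (∀ p t → ⟦ A ⟧ᵖ p → ⟦ B ⟧ᵗ t → SN ((u [ p ]₀) [ t ]ₖ)) →
    ⟦ A ⇒ B ⟧ᵖ (lamPair u)
  lamPair-reducible A B u h t (inj₁ refl) = acc λ { (_ , ()) }
  lamPair-reducible A B u h t (inj₂ (p , t′ , refl , ⊨p , ⊨t′)) =
    acc λ { (_ , r-pairPair _) → h p t′ ⊨p ⊨t′ }

  lamX-reducible : ∀ A u → (∀ p → ⟦ A ⟧ᵖ p → SN (u [ p ]₀)) → ⟦ A ⟧ᵗ (lamX u)
  lamX-reducible A u h p ⊨p = acc λ { (_ , r-lamX _) → h p ⊨p }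

  Reducible : ∀ {m} → Ctx m → (Fin m → PTerm n) → Set
  Reducible Γ σ = ∀ i → ⟦ lookup Γ i ⟧ᵖ (σ i)

  reducible-∷ : ∀ {m} {Γ : Ctx m} {σ A p} →
    ⟦ A ⟧ᵖ p → Reducible Γ σ → Reducible (A ∷ Γ) (p ∷ˢ σ)
  reducible-∷ ⊨p ⊨σ zero    = ⊨p
  reducible-∷ ⊨p ⊨σ (suc i) = ⊨σ i

  -- A term typed under  * : A  has no free k, so substituting s for k is
  -- harmless and both kinds of declaration can be interpreted alike.
  fundamentalᵖ : ∀ {m} {Γ : Ctx m} {p A} → Γ ⊢p p ∶ A →
    ∀ σ → Reducible Γ σ → ⟦ A ⟧ᵖ (subP σ p)
  fundamentalᵗ : ∀ {m} {Γ : Ctx m} {δ t A} → Γ ▷ δ ⊢t t ∶ A →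
    ∀ σ → Reducible Γ σ → ∀ s → ⟦ declTy δ ⟧ᵗ s → ⟦ A ⟧ᵗ (ksubT s (subT σ t))
  fundamentalᵉ : ∀ {m} {Γ : Ctx m} {δ u} → Γ ▷ δ ⊢e u →
    ∀ σ → Reducible Γ σ → ∀ s → ⟦ declTy δ ⟧ᵗ s → SN (ksubE s (subE σ u))

  fundamentalᵖ (ty-var i) σ ⊨σ = ⊨σ i
  fundamentalᵖ (ty-lamPair {A} {B} {u} ⊢u) σ ⊨σ =
    lamPair-reducible A B (subE (extS σ) u) λ p t ⊨p ⊨t →
      subst (SN ∘ ksubE t) (sym (single-extS p σ u))
        (fundamentalᵉ ⊢u (p ∷ˢ σ) (reducible-∷ ⊨p ⊨σ) t ⊨t)
  fundamentalᵖ (ty-lamK {A} {u} ⊢u) σ ⊨σ = lamK-reducible A (subE σ u) (fundamentalᵉ ⊢u σ ⊨σ)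

  fundamentalᵗ (ty-kvar refl) σ ⊨σ s ⊨s = ⊨s
  fundamentalᵗ (ty-star refl) σ ⊨σ s ⊨s = star-reducible _
  fundamentalᵗ (ty-pair {A} {p = p} ⊢p ⊢t) σ ⊨σ s ⊨s =
    pair-reducible (subst ⟦ A ⟧ᵖ (sym (ksubP-vacuous s (subP σ p))) (fundamentalᵖ ⊢p σ ⊨σ))
                   (fundamentalᵗ ⊢t σ ⊨σ s ⊨s)
  fundamentalᵗ (ty-lamX {A} {u} ⊢u) σ ⊨σ s ⊨s = lamX-reducible A _ λ p ⊨p →
    subst SN (instantiate p) (fundamentalᵉ ⊢u (p ∷ˢ σ) (reducible-∷ ⊨p ⊨σ) s ⊨s)
    where
    open ≡-Reasoning
    instantiate : ∀ p → ksubE s (subE (p ∷ˢ σ) u) ≡ ksubE (renT suc s) (subE (extS σ) u) [ p ]₀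
    instantiate p = sym (begin
      subE (single p) (ksubE (renT suc s) (subE (extS σ) u))
        ≡⟨ subE-ksubE (single p) (renT suc s) (subE (extS σ) u) ⟩
      ksubE (subT (single p) (renT suc s)) (subE (extS σ) u [ p ]₀)
        ≡⟨ cong₂ ksubE (single-renT-suc p s) (single-extS p σ u) ⟩
      ksubE s (subE (p ∷ˢ σ) u)
        ∎)

  fundamentalᵉ (ty-cut {A} {p = p} ⊢p ⊢t) σ ⊨σ s ⊨s =
    fundamentalᵗ ⊢t σ ⊨σ s ⊨s _
      (subst ⟦ A ⟧ᵖ (sym (ksubP-vacuous s (subP σ p))) (fundamentalᵖ ⊢p σ ⊨σ))
  fundamentalᵉ (ty-app (ty-lamBarK ⊢u) ⊢t) σ ⊨σ s ⊨s =
    acc λ { (_ , r-lamBarK _) → fundamentalᵉ ⊢u σ ⊨σ _ (fundamentalᵗ ⊢t σ ⊨σ s ⊨s) }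

strongNormalisation : ∀ {n} {Γ : Ctx n} {δ u} → Γ ▷ δ ⊢e u → SN u
strongNormalisation {n} {Γ} {δ} {u} ⊢u =
  subst SN (trans (ksubE-kvar (subE var u)) (subE-id var (λ _ → refl) u))
    (fundamentalᵉ ⊢u var (λ i → var-reducible (lookup Γ i) i) kvar (kvar-reducible (declTy δ)))
  where open Reducibility n

theorem1 : ∀ {n} (Γ : Ctx n) (δ : Decl) (u : ETerm n) →
    Γ ▷ δ ⊢e u → TClosedE u →
    ¬ (Σ (ℕ → ETerm n) (λ f → (f zero ≡ u) × (∀ i → f i ⟶ f (suc i))))
theorem1 Γ δ u ⊢u _ = acc⇒¬infiniteDescent (strongNormalisation ⊢u)
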